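{- Let $k\ge 1$, $n\ge 3$ and $T_{4k,n}=C_{4k}\Box C_n$. Then $\chi(T_{4k,n}^2)\le 6$ if $n\equiv 0\pmod 3$; $\chi(T_{4k,n}^2)\le 8$ if $n=4$; and $\chi(T_{4k,n}^2)\le 7$ otherwise.
   Context: $C_j$ denotes the cycle on $j$ vertices; $\Box$ is the Cartesian product of graphs. The square $G^2$ of a graph $G$ has vertex set $V(G)$, two distinct vertices being adjacent iff their distance in $G$ is at most 2. $\chi$ is the chromatic number. -}

module Defs where

open import Level using (Level; suc; _⊔_)
open import Data.Nat using (ℕ; NonZero; _+_; _%_)
open import Data.Fin using (Fin; toℕ)
open import Data.Product using (Σ; _×_; _,_)
open import Data.Sum using (_⊎_)
open import Relation.Binary.PropositionalEquality using (_≡_)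
open import Relation.Nullary using (¬_)

record Graph : Set₁ where
  field
    V   : Set
    Adj : V → V → Set
open Graph public

Cycle : (j : ℕ) → .{{_ : NonZero j}} → Graph
Cycle j = record
  { V   = Fin j
  ; Adj = λ u v → (toℕ v ≡ (toℕ u + 1) % j) ⊎ (toℕ u ≡ (toℕ v + 1) % j)
  }

_□_ : Graph → Graph → Graph
G □ H = record
  { V   = V G × V H
  ; Adj = λ { (g , h) (g' , h') →
              (Adj G g g' × h ≡ h') ⊎ (g ≡ g' × Adj H h h') }
  }

square : Graph → Graph
square G = record
  { V   = V G
  ; Adj = λ u v → ¬ (u ≡ v) × (Adj G u v ⊎ Σ (V G) (λ w → Adj G u w × Adj G w v))
  }

ProperColouring : Graph → ℕ → Set
ProperColouring G c =
  Σ (V G → Fin c) (λ f → ∀ u v → Adj G u v → ¬ (f u ≡ f v))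

χ≤ : Graph → ℕ → Set
χ≤ G c = ProperColouring G c

open import Data.Nat using (_*_; _≤_; s≤s; z≤n; >-nonZero)
open import Data.Nat.Properties using (*-monoʳ-≤; ≤-trans)

Torus : (k n : ℕ) → 1 ≤ k → 3 ≤ n → Graph
Torus k n 1≤k 3≤n =
  Cycle (4 * k) {{>-nonZero (≤-trans (s≤s z≤n) (*-monoʳ-≤ 4 1≤k))}} □ Cycle n {{>-nonZero (≤-trans (s≤s z≤n) 3≤n)}}

-- The colourings are "tilings".  A tile pattern consists of row types (here the
-- four residues mod 4, stepped by r ↦ r + 1), column types joined by a directed
-- column graph, and a colour for every pair (row type, column type), subject to
-- six local conditions saying that two cells at distance at most 2 never share a
-- colour.  Row a of the torus gets row type a mod 4 and the columns of C_n follow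
-- a closed walk of length n in the column graph; the vertex (a , b) gets the
-- colour of its pair of types.
-- The theorem then picks the pattern according to n: columns cycle with period 3
-- when 3 ∣ n, with period 4 when n = 4, and otherwise run through a detour of
-- length 5 or 7 followed by the 3-cycle, matching n ≡ 2 or n ≡ 1 (mod 3).
module Submission where

open import Defs
open import Data.Nat using (ℕ; zero; suc; _+_; _*_; _≤_; _<_; _%_; _/_; _≡ᵇ_; NonZero; s≤s)
open import Data.Nat.Properties using (+-comm; *-comm; m≤n⇒m<n∨m≡n; suc-injective)
open import Data.Nat.DivMod using (m<n⇒m%n≡m; n%n≡0; m≡m%n+[m/n]*n; m%n<n)
open import Data.Fin using (Fin; toℕ; _↑ˡ_; #_)
open import Data.Fin.Patterns using (0F; 1F; 2F; 3F)
open import Data.Fin.Properties using (toℕ<n; toℕ-injective; all?) renaming (_≟_ to _≟ᶠ_)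
open import Data.Vec using (Vec; []; _∷_; lookup)
open import Data.List using (List; []; _∷_)
open import Data.Bool.ListAction using (any)
open import Data.Bool using (Bool; T)
open import Data.Unit using (tt)
open import Data.Product using (_×_; _,_; ∃-syntax)
open import Data.Sum using (_⊎_; inj₁; inj₂)
open import Data.Empty using (⊥-elim)
open import Function using (_∘_)
open import Relation.Binary.PropositionalEquality
open import Relation.Nullary using (¬_; Dec; ¬?)
open import Relation.Nullary.Decidable using (map′; from-yes; ⌊_⌋; fromWitness; T?; _×-dec_; _→-dec_)

Step : (m : ℕ) .{{_ : NonZero m}} → Fin m → Fin m → Set
Step m i j = toℕ j ≡ (toℕ i + 1) % m

step-cases : ∀ {m} .{{_ : NonZero m}} {i j : Fin m} → Step m i j →
  toℕ j ≡ suc (toℕ i) ⊎ (suc (toℕ i) ≡ m × toℕ j ≡ 0)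
step-cases {m} {i} st with m≤n⇒m<n∨m≡n (toℕ<n i)
... | inj₁ i+1<m = inj₁ (trans st (trans (cong (_% m) (+-comm (toℕ i) 1)) (m<n⇒m%n≡m i+1<m)))
... | inj₂ i+1≡m = inj₂ (i+1≡m , trans st (trans (cong (_% m) (trans (+-comm (toℕ i) 1) i+1≡m)) (n%n≡0 m)))

step-functional : ∀ {m} .{{_ : NonZero m}} {i j j' : Fin m} → Step m i j → Step m i j' → j ≡ j'
step-functional st st' = toℕ-injective (trans st (sym st'))

step-injective : ∀ {m} .{{_ : NonZero m}} {i i' j : Fin m} → Step m i j → Step m i' j → i ≡ i'
step-injective st st' = toℕ-injective (suc-injective (same-source (step-cases st) (step-cases st')))
  where
  same-source : ∀ {x x' y m : ℕ} → y ≡ suc x ⊎ (suc x ≡ m × y ≡ 0) → y ≡ suc x' ⊎ (suc x' ≡ m × y ≡ 0) →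
    suc x ≡ suc x'
  same-source (inj₁ y≡x+1)       (inj₁ y≡x'+1)       = trans (sym y≡x+1) y≡x'+1
  same-source (inj₁ y≡x+1)       (inj₂ (_ , y≡0))    with trans (sym y≡x+1) y≡0
  ... | ()
  same-source (inj₂ (_ , y≡0))   (inj₁ y≡x'+1)       with trans (sym y≡x'+1) y≡0
  ... | ()
  same-source (inj₂ (x+1≡m , _)) (inj₂ (x'+1≡m , _)) = trans x+1≡m (sym x'+1≡m)

ClosedWalk : {S : Set} → (S → S → Set) → (m : ℕ) .{{_ : NonZero m}} → (Fin m → S) → Set
ClosedWalk E m σ = ∀ i j → Step m i j → E (σ i) (σ j)

Walk : {S : Set} → (S → S → Set) → (ℕ → S) → Set
Walk E σ = ∀ x → E (σ x) (σ (suc x))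

closedWalk : ∀ {S} {E : S → S → Set} {σ : ℕ → S} m .{{_ : NonZero m}} →
  Walk E σ → σ m ≡ σ 0 → ClosedWalk E m (σ ∘ toℕ)
closedWalk {E = E} {σ} m walk returns i j st with step-cases st
... | inj₁ j≡i+1         = subst (E (σ (toℕ i))) (cong σ (sym j≡i+1)) (walk (toℕ i))
... | inj₂ (i+1≡m , j≡0) =
  subst (E (σ (toℕ i))) (trans (cong σ i+1≡m) (trans returns (cong σ (sym j≡0)))) (walk (toℕ i))

orbit : {S : Set} → (S → S) → S → ℕ → S
orbit f a zero    = a
orbit f a (suc x) = f (orbit f a x)

orbit-+ : ∀ {S} (f : S → S) a m x → orbit f a (m + x) ≡ orbit f (orbit f a x) m
orbit-+ f a zero    x = refl
orbit-+ f a (suc m) x = cong f (orbit-+ f a m x)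

orbit-periodic : ∀ {S} (f : S → S) p → (∀ s → orbit f s p ≡ s) → ∀ a q → orbit f a (q * p) ≡ a
orbit-periodic f p period a zero    = refl
orbit-periodic f p period a (suc q) = begin
  orbit f a (p + q * p)             ≡⟨ orbit-+ f a p (q * p) ⟩
  orbit f (orbit f a (q * p)) p     ≡⟨ period _ ⟩
  orbit f a (q * p)                 ≡⟨ orbit-periodic f p period a q ⟩
  a                                 ∎
  where open ≡-Reasoning

_⊕_ : {S : Set} → List S → (ℕ → S) → ℕ → S
([] ⊕ τ) x             = τ x
((s ∷ ss) ⊕ τ) zero    = s
((s ∷ ss) ⊕ τ) (suc x) = (ss ⊕ τ) x

Leads : {S : Set} → (S → S → Set) → S → List S → S → Set
Leads E s []        t = E s t
Leads E s (s' ∷ ss) t = E s s' × Leads E s' ss t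

prefix-walk : ∀ {S} {E : S → S → Set} {τ : ℕ → S} s ss →
  Leads E s ss (τ 0) → Walk E τ → Walk E ((s ∷ ss) ⊕ τ)
prefix-walk s []        leads       walk zero    = leads
prefix-walk s []        leads       walk (suc x) = walk x
prefix-walk s (s' ∷ ss) (e , leads) walk zero    = e
prefix-walk s (s' ∷ ss) (e , leads) walk (suc x) = prefix-walk s' ss leads walk x

-- The local conditions of a tile pattern: cells at distance 1 or 2 (along a row,
-- along a column, or diagonally) get different colours.  `next` steps the row
-- type, `Edge` is the directed column graph.
record IsTilePattern {c : ℕ} {Row Col : Set} (next : Row → Row)
         (Edge : Col → Col → Set) (colour : Row → Col → Fin c) : Set where
  constructor tilePattern
  field
    row-step  : ∀ r s → ¬ colour r s ≡ colour (next r) s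
    row-step² : ∀ r s → ¬ colour r s ≡ colour (next (next r)) s
    col-step  : ∀ s t → Edge s t → ∀ r → ¬ colour r s ≡ colour r t
    col-step² : ∀ s t u → Edge s t → Edge t u → ∀ r → ¬ colour r s ≡ colour r u
    diagonal  : ∀ s t → Edge s t → ∀ r → ¬ colour r s ≡ colour (next r) t
    antidiag  : ∀ s t → Edge s t → ∀ r → ¬ colour (next r) s ≡ colour r t

module Tiling {c : ℕ} {Row Col : Set} {next : Row → Row} {Edge : Col → Col → Set}
  {colour : Row → Col → Fin c} (tiles : IsTilePattern next Edge colour)
  (M n : ℕ) .{{_ : NonZero M}} .{{_ : NonZero n}}
  (R : Fin M → Row) (rows : ClosedWalk (λ r r' → r' ≡ next r) M R)
  (C : Fin n → Col) (cols : ClosedWalk Edge n C) where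

  open IsTilePattern tiles

  Cell : Set
  Cell = Fin M × Fin n

  tile : Cell → Fin c
  tile (a , b) = colour (R a) (C b)

  data Move : Cell → Cell → Set where
    right : ∀ {a a' b} → Step M a a' → Move (a , b) (a' , b)
    left  : ∀ {a a' b} → Step M a' a → Move (a , b) (a' , b)
    up    : ∀ {a b b'} → Step n b b' → Move (a , b) (a , b')
    down  : ∀ {a b b'} → Step n b' b → Move (a , b) (a , b')

  move : ∀ {u v} → Adj (Cycle M □ Cycle n) u v → Move u v
  move (inj₁ (inj₁ st , refl)) = right st
  move (inj₁ (inj₂ st , refl)) = left st
  move (inj₂ (refl , inj₁ st)) = up st
  move (inj₂ (refl , inj₂ st)) = down st

  shift : ∀ {a a'} b → Step M a a' → tile (a' , b) ≡ colour (next (R a)) (C b)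
  shift b st = cong (λ r → colour r (C b)) (rows _ _ st)

  shift² : ∀ {a a₁ a'} b → Step M a a₁ → Step M a₁ a' → tile (a' , b) ≡ colour (next (next (R a))) (C b)
  shift² b s₁ s₂ = trans (shift b s₂) (cong (λ r → colour (next r) (C b)) (rows _ _ s₁))

  one-move : ∀ {u v} → Move u v → ¬ tile u ≡ tile v
  one-move {a , b} (right st) eq = row-step (R a) (C b) (trans eq (shift b st))
  one-move {_ , b} (left st)  eq = row-step _ (C b) (trans (sym eq) (shift b st))
  one-move {a , _} (up st)    eq = col-step _ _ (cols _ _ st) (R a) eq
  one-move {a , _} (down st)  eq = col-step _ _ (cols _ _ st) (R a) (sym eq)

  two-moves : ∀ {u w v} → ¬ u ≡ v → Move u w → Move w v → ¬ tile u ≡ tile v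
  two-moves {a , b} _ (right s₁) (right s₂) eq = row-step² (R a) (C b) (trans eq (shift² b s₁ s₂))
  two-moves {_ , b} _ (left s₁)  (left s₂)  eq = row-step² _ (C b) (trans (sym eq) (shift² b s₂ s₁))
  two-moves {a , _} _ (up s₁)    (up s₂)    eq = col-step² _ _ _ (cols _ _ s₁) (cols _ _ s₂) (R a) eq
  two-moves {a , _} _ (down s₁)  (down s₂)  eq = col-step² _ _ _ (cols _ _ s₂) (cols _ _ s₁) (R a) (sym eq)
  -- going back and forth returns to the start
  two-moves u≢v (right s₁) (left s₂)  = ⊥-elim (u≢v (cong (_, _) (step-injective s₁ s₂)))
  two-moves u≢v (left s₁)  (right s₂) = ⊥-elim (u≢v (cong (_, _) (step-functional s₁ s₂)))
  two-moves u≢v (up s₁)    (down s₂)  = ⊥-elim (u≢v (cong (_ ,_) (step-injective s₁ s₂)))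
  two-moves u≢v (down s₁)  (up s₂)    = ⊥-elim (u≢v (cong (_ ,_) (step-functional s₁ s₂)))
  two-moves {a , _} _ (right s₁) (up s₂)    eq = diagonal _ _ (cols _ _ s₂) (R a) (trans eq (shift _ s₁))
  two-moves {a , _} _ (right s₁) (down s₂)  eq = antidiag _ _ (cols _ _ s₂) (R a) (sym (trans eq (shift _ s₁)))
  two-moves _         (left s₁)  (up s₂)    eq = antidiag _ _ (cols _ _ s₂) _ (trans (sym (shift _ s₁)) eq)
  two-moves _         (left s₁)  (down s₂)  eq = diagonal _ _ (cols _ _ s₂) _ (sym (trans (sym (shift _ s₁)) eq))
  two-moves {a , _} _ (up s₁)    (right s₂) eq = diagonal _ _ (cols _ _ s₁) (R a) (trans eq (shift _ s₂))
  two-moves _         (up s₁)    (left s₂)  eq = antidiag _ _ (cols _ _ s₁) _ (trans (sym (shift _ s₂)) eq)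
  two-moves {a , _} _ (down s₁)  (right s₂) eq = antidiag _ _ (cols _ _ s₁) (R a) (sym (trans eq (shift _ s₂)))
  two-moves _         (down s₁)  (left s₂)  eq = diagonal _ _ (cols _ _ s₁) _ (sym (trans (sym (shift _ s₂)) eq))

  colouring : χ≤ (square (Cycle M □ Cycle n)) c
  colouring = tile , proper
    where
    proper : ∀ u v → Adj (square (Cycle M □ Cycle n)) u v → ¬ tile u ≡ tile v
    proper u v (_   , inj₁ uv)             = one-move (move uv)
    proper u v (u≢v , inj₂ (w , uw , wv)) = two-moves u≢v (move uw) (move wv)

next4 : Fin 4 → Fin 4
next4 0F = 1F
next4 1F = 2F
next4 2F = 3F
next4 3F = 0F

next4-period : ∀ r → orbit next4 r 4 ≡ r
next4-period 0F = refl
next4-period 1F = refl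
next4-period 2F = refl
next4-period 3F = refl

EdgeOf : ∀ {m} → (Fin m → Fin m → Bool) → Fin m → Fin m → Set
EdgeOf edge s t = T (edge s t)

isTilePattern? : ∀ {c p m} (next : Fin p → Fin p) (edge : Fin m → Fin m → Bool)
  (colour : Fin p → Fin m → Fin c) → Dec (IsTilePattern next (EdgeOf edge) colour)
isTilePattern? next edge colour =
  map′ (λ (p₁ , p₂ , p₃ , p₄ , p₅ , p₆) → tilePattern p₁ p₂ p₃ p₄ p₅ p₆)
       (λ (tilePattern p₁ p₂ p₃ p₄ p₅ p₆) → p₁ , p₂ , p₃ , p₄ , p₅ , p₆)
       ( all? (λ r → all? (λ s → ¬? (colour r s ≟ᶠ colour (next r) s)))
  ×-dec all? (λ r → all? (λ s → ¬? (colour r s ≟ᶠ colour (next (next r)) s)))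
  ×-dec all? (λ s → all? (λ t → edge? s t →-dec all? (λ r → ¬? (colour r s ≟ᶠ colour r t))))
  ×-dec all? (λ s → all? (λ t → all? (λ u → edge? s t →-dec edge? t u →-dec
          all? (λ r → ¬? (colour r s ≟ᶠ colour r u)))))
  ×-dec all? (λ s → all? (λ t → edge? s t →-dec all? (λ r → ¬? (colour r s ≟ᶠ colour (next r) t))))
  ×-dec all? (λ s → all? (λ t → edge? s t →-dec all? (λ r → ¬? (colour (next r) s ≟ᶠ colour r t)))))
  where
  edge? : ∀ s t → Dec (EdgeOf edge s t)
  edge? s t = T? (edge s t)

graphOf : ∀ {m} → (Fin m → Fin m) → Fin m → Fin m → Bool
graphOf f s t = ⌊ t ≟ᶠ f s ⌋

graphOf-walk : ∀ {m} (f : Fin m → Fin m) a → Walk (EdgeOf (graphOf f)) (orbit f a)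
graphOf-walk f a x = fromWitness refl

-- A table lists, for each column type, the colours of its four row types.
colourOf : ∀ {c m} → Vec (Vec (Fin c) 4) m → Fin 4 → Fin m → Fin c
colourOf table r s = lookup (lookup table s) r

next3 : Fin 3 → Fin 3
next3 0F = 1F
next3 1F = 2F
next3 2F = 0F

next3-period : ∀ s → orbit next3 s 3 ≡ s
next3-period 0F = refl
next3-period 1F = refl
next3-period 2F = refl

table6 : Vec (Vec (Fin 6) 4) 3
table6 = (# 0 ∷ # 3 ∷ # 1 ∷ # 4 ∷ [])
       ∷ (# 1 ∷ # 4 ∷ # 2 ∷ # 5 ∷ [])
       ∷ (# 2 ∷ # 5 ∷ # 0 ∷ # 3 ∷ [])
       ∷ []

pattern6 : IsTilePattern next4 (EdgeOf (graphOf next3)) (colourOf table6)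
pattern6 = from-yes (isTilePattern? next4 (graphOf next3) (colourOf table6))

table8 : Vec (Vec (Fin 8) 4) 4
table8 = (# 0 ∷ # 4 ∷ # 2 ∷ # 6 ∷ [])
       ∷ (# 1 ∷ # 5 ∷ # 3 ∷ # 7 ∷ [])
       ∷ (# 2 ∷ # 6 ∷ # 0 ∷ # 4 ∷ [])
       ∷ (# 3 ∷ # 7 ∷ # 1 ∷ # 5 ∷ [])
       ∷ []

pattern8 : IsTilePattern next4 (EdgeOf (graphOf next4)) (colourOf table8)
pattern8 = from-yes (isTilePattern? next4 (graphOf next4) (colourOf table8))

-- Seven colours: eleven column types.  The column graph has the closed walks
-- 0 1 2, 0 1 3 4 5 and 0 1 6 7 8 9 10 of lengths 3, 5 and 7 through 0.
table7 : Vec (Vec (Fin 7) 4) 11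
table7 = (# 0 ∷ # 1 ∷ # 2 ∷ # 3 ∷ []) ∷ (# 2 ∷ # 4 ∷ # 5 ∷ # 1 ∷ []) ∷ (# 5 ∷ # 3 ∷ # 0 ∷ # 4 ∷ [])
       ∷ (# 3 ∷ # 0 ∷ # 6 ∷ # 4 ∷ []) ∷ (# 1 ∷ # 2 ∷ # 3 ∷ # 5 ∷ []) ∷ (# 4 ∷ # 5 ∷ # 0 ∷ # 6 ∷ [])
       ∷ (# 3 ∷ # 0 ∷ # 6 ∷ # 4 ∷ []) ∷ (# 6 ∷ # 1 ∷ # 2 ∷ # 5 ∷ []) ∷ (# 0 ∷ # 4 ∷ # 3 ∷ # 1 ∷ [])
       ∷ (# 2 ∷ # 5 ∷ # 6 ∷ # 4 ∷ []) ∷ (# 6 ∷ # 3 ∷ # 0 ∷ # 5 ∷ [])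
       ∷ []

successors7 : ℕ → List ℕ
successors7 0  = 1 ∷ []
successors7 1  = 2 ∷ 3 ∷ 6 ∷ []
successors7 2  = 0 ∷ []
successors7 3  = 4 ∷ []
successors7 4  = 5 ∷ []
successors7 5  = 0 ∷ []
successors7 6  = 7 ∷ []
successors7 7  = 8 ∷ []
successors7 8  = 9 ∷ []
successors7 9  = 10 ∷ []
successors7 10 = 0 ∷ []
successors7 _  = []

edge7 : Fin 11 → Fin 11 → Bool
edge7 s t = any (toℕ t ≡ᵇ_) (successors7 (toℕ s))

pattern7 : IsTilePattern next4 (EdgeOf edge7) (colourOf table7)
pattern7 = from-yes (isTilePattern? next4 edge7 (colourOf table7))

triangle7 : ℕ → Fin 11
triangle7 = (_↑ˡ 8) ∘ orbit next3 0F

triangle7-walk : Walk (EdgeOf edge7) triangle7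
triangle7-walk x = triangle-edge (orbit next3 0F x)
  where
  triangle-edge : ∀ s → EdgeOf edge7 (s ↑ˡ 8) (next3 s ↑ˡ 8)
  triangle-edge 0F = tt
  triangle-edge 1F = tt
  triangle-edge 2F = tt

triangle7-periodic : ∀ q → triangle7 (q * 3) ≡ # 0
triangle7-periodic q = cong (_↑ˡ 8) (orbit-periodic next3 3 next3-period 0F q)

detour5 detour7 : ℕ → Fin 11
detour5 = (# 0 ∷ # 1 ∷ # 3 ∷ # 4 ∷ # 5 ∷ []) ⊕ triangle7
detour7 = (# 0 ∷ # 1 ∷ # 6 ∷ # 7 ∷ # 8 ∷ # 9 ∷ # 10 ∷ []) ⊕ triangle7

detour5-walk : Walk (EdgeOf edge7) detour5
detour5-walk = prefix-walk {E = EdgeOf edge7} {τ = triangle7} _ _ (tt , tt , tt , tt , tt) triangle7-walk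

detour7-walk : Walk (EdgeOf edge7) detour7
detour7-walk = prefix-walk {E = EdgeOf edge7} {τ = triangle7} _ _ (tt , tt , tt , tt , tt , tt , tt) triangle7-walk

tileTorus : ∀ {c m} {edge : Fin m → Fin m → Bool} {colour : Fin 4 → Fin m → Fin c}
  (k n : ℕ) (1≤k : 1 ≤ k) (3≤n : 3 ≤ n) → IsTilePattern next4 (EdgeOf edge) colour →
  (σ : ℕ → Fin m) → Walk (EdgeOf edge) σ → σ n ≡ σ 0 →
  χ≤ (square (Torus k n 1≤k 3≤n)) c
tileTorus {edge = edge} k n@(suc _) (s≤s _) _ tiles σ walk returns =
  Tiling.colouring tiles (4 * k) n _ rows _ (closedWalk {E = EdgeOf edge} {σ = σ} n walk returns)
  where
  rows : ClosedWalk (λ r r' → r' ≡ next4 r) (4 * k) (orbit next4 0F ∘ toℕ)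
  rows = closedWalk {E = λ r r' → r' ≡ next4 r} {σ = orbit next4 0F} (4 * k) (λ _ → refl)
    (trans (cong (orbit next4 0F) (*-comm 4 k)) (orbit-periodic next4 4 next4-period 0F k))

length-5-or-7 : ∀ n → 3 ≤ n → ¬ n ≡ 4 → ¬ n % 3 ≡ 0 →
  (∃[ q ] n ≡ 5 + q * 3) ⊎ (∃[ q ] n ≡ 7 + q * 3)
length-5-or-7 n 3≤n n≢4 n%3≢0 =
  subst Goal (sym n≡) (split (n % 3) (n / 3) (m%n<n n 3) n%3≢0 (subst (3 ≤_) n≡ 3≤n) (n≢4 ∘ trans n≡))
  where
  n≡ : n ≡ n % 3 + (n / 3) * 3
  n≡ = m≡m%n+[m/n]*n n 3
  Goal : ℕ → Set
  Goal m = (∃[ q ] m ≡ 5 + q * 3) ⊎ (∃[ q ] m ≡ 7 + q * 3)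
  split : ∀ r p → r < 3 → ¬ r ≡ 0 → 3 ≤ r + p * 3 → ¬ r + p * 3 ≡ 4 → Goal (r + p * 3)
  split 0 _ _ r≢0 _ _                     = ⊥-elim (r≢0 refl)
  split 1 0 _ _ (s≤s ()) _
  split 1 1 _ _ _ ≢4                      = ⊥-elim (≢4 refl)
  split 1 (suc (suc q)) _ _ _ _           = inj₂ (q , refl)
  split 2 0 _ _ (s≤s (s≤s ())) _
  split 2 (suc q) _ _ _ _                 = inj₁ (q , refl)
  split (suc (suc (suc _))) _ (s≤s (s≤s (s≤s ()))) _ _ _

corollary3 : (k n : ℕ) (1≤k : 1 ≤ k) (3≤n : 3 ≤ n) →
    ((n % 3 ≡ 0) → χ≤ (square (Torus k n 1≤k 3≤n)) 6) ×
    ((n ≡ 4) → χ≤ (square (Torus k n 1≤k 3≤n)) 8) ×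
    (¬ (n % 3 ≡ 0) → ¬ (n ≡ 4) → χ≤ (square (Torus k n 1≤k 3≤n)) 7)
corollary3 k n 1≤k 3≤n = six , eight , seven
  where
  tileWith : ∀ {c m} {edge : Fin m → Fin m → Bool} {colour : Fin 4 → Fin m → Fin c} →
    IsTilePattern next4 (EdgeOf edge) colour → (σ : ℕ → Fin m) → Walk (EdgeOf edge) σ →
    σ n ≡ σ 0 → χ≤ (square (Torus k n 1≤k 3≤n)) c
  tileWith = tileTorus k n 1≤k 3≤n

  six : n % 3 ≡ 0 → χ≤ (square (Torus k n 1≤k 3≤n)) 6
  six n%3≡0 = tileWith pattern6 (orbit next3 0F) (graphOf-walk next3 0F)
    (trans (cong (orbit next3 0F) (trans (m≡m%n+[m/n]*n n 3) (cong (_+ (n / 3) * 3) n%3≡0)))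
           (orbit-periodic next3 3 next3-period 0F (n / 3)))

  eight : n ≡ 4 → χ≤ (square (Torus k n 1≤k 3≤n)) 8
  eight refl = tileWith pattern8 (orbit next4 0F) (graphOf-walk next4 0F) refl

  seven : ¬ n % 3 ≡ 0 → ¬ n ≡ 4 → χ≤ (square (Torus k n 1≤k 3≤n)) 7
  seven n%3≢0 n≢4 with length-5-or-7 n 3≤n n≢4 n%3≢0
  ... | inj₁ (q , refl) = tileWith pattern7 detour5 detour5-walk (triangle7-periodic q)
  ... | inj₂ (q , refl) = tileWith pattern7 detour7 detour7-walk (triangle7-periodic q)
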